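{- There exists a function $\beta(n) = O\left(\frac{n}{\log n}\right)$ such that $\mu(G) \le \beta(n) \cdot \mathit{gp}(G)$ for every graph $G$ of diameter $2$ with $n$ vertices.
   Context: For $X \subseteq V(G)$, two vertices $x,y$ are $X$-visible if some shortest $x,y$-path has no internal vertex in $X$; $X$ is a mutual-visibility set if every two vertices of $X$ are $X$-visible, and $\mu(G)$ is the maximum size of such a set. A set $X$ is a general position set if no shortest path of $G$ contains three distinct vertices of $X$; $\mathit{gp}(G)$ is the maximum size of such a set. -}

module Defs where

open import Data.Nat using (ℕ; zero; suc; _+_; _*_; _≤_)
open import Data.Nat.Logarithm using (⌊log₂_⌋)
open import Data.Fin using (Fin)
open import Data.Fin.Subset using (Subset; _∈_; _∉_; ∣_∣)
open import Data.List using (List; []; _∷_)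
open import Data.List.Relation.Unary.All using (All)
import Data.List.Membership.Propositional as LM
open import Data.Product using (Σ; ∃; _×_; Σ-syntax; ∃-syntax)
open import Data.Empty using (⊥)
open import Relation.Nullary using (¬_)
open import Relation.Binary.PropositionalEquality using (_≡_; _≢_)

record Graph (n : ℕ) : Set₁ where
  field
    Adj     : Fin n → Fin n → Set
    sym     : ∀ {x y} → Adj x y → Adj y x
    irrefl  : ∀ {x} → ¬ Adj x x

module _ {n : ℕ} (G : Graph n) where
  open Graph G

  data Walk : Fin n → Fin n → Set where
    []  : ∀ {x} → Walk x x
    _∷_ : ∀ {x z y} → Adj x z → Walk z y → Walk x y

  length : ∀ {x y} → Walk x y → ℕ
  length []      = 0
  length (_ ∷ w) = suc (length w)

  vertices : ∀ {x y} → Walk x y → List (Fin n)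
  vertices {x} []      = x ∷ []
  vertices {x} (_ ∷ w) = x ∷ vertices w

  verticesInit : ∀ {x y} → Walk x y → List (Fin n)
  verticesInit []          = []
  verticesInit {x} (_ ∷ w) = x ∷ verticesInit w

  -- internal vertices (all except the two end vertices)
  internals : ∀ {x y} → Walk x y → List (Fin n)
  internals []      = []
  internals (_ ∷ w) = verticesInit w

  IsShortest : ∀ {x y} → Walk x y → Set
  IsShortest {x} {y} w = ∀ (w' : Walk x y) → length w ≤ length w'

  HasDiameter : ℕ → Set
  HasDiameter d =
    (∀ x y → Σ[ w ∈ Walk x y ] length w ≤ d) ×
    (∃[ x ] ∃[ y ] ∀ (w : Walk x y) → d ≤ length w)

  Visible : Subset n → Fin n → Fin n → Set
  Visible X x y = Σ[ w ∈ Walk x y ] IsShortest w × All (_∉ X) (internals w)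

  IsMutualVisibilitySet : Subset n → Set
  IsMutualVisibilitySet X = ∀ x y → x ∈ X → y ∈ X → Visible X x y

  IsGeneralPositionSet : Subset n → Set
  IsGeneralPositionSet X =
    ∀ {x y} (w : Walk x y) → IsShortest w →
    ∀ a b c → a ∈ X → b ∈ X → c ∈ X → a ≢ b → a ≢ c → b ≢ c →
    ¬ (a LM.∈ vertices w × b LM.∈ vertices w × c LM.∈ vertices w)

  IsMutualVisibilityNumber : ℕ → Set
  IsMutualVisibilityNumber k =
    (∃[ X ] IsMutualVisibilitySet X × ∣ X ∣ ≡ k) ×
    (∀ X → IsMutualVisibilitySet X → ∣ X ∣ ≤ k)

  IsGeneralPositionNumber : ℕ → Set
  IsGeneralPositionNumber k =
    (∃[ X ] IsGeneralPositionSet X × ∣ X ∣ ≡ k) ×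
    (∀ X → IsGeneralPositionSet X → ∣ X ∣ ≤ k)

-- β(n) = O(n / log n): there are constants C, N with β(n) · ⌊log₂ n⌋ ≤ C · n for n ≥ N
IsBigO-n/logn : (ℕ → ℕ) → Set
IsBigO-n/logn β = ∃[ C ] ∃[ N ] ∀ n → N ≤ n → β n * ⌊log₂ n ⌋ ≤ C * n

{-# OPTIONS --safe #-}
module Submission where

-- A mutual-visibility set has at most n vertices, so it suffices that n < 2 ^ (2 gp).  Erdős–Szekeres:
-- splitting off a vertex and recursing into its larger (non-)neighbourhood yields a clique A and an
-- independent set B with n < 2 ^ (|A| + |B|).  In diameter 2 a shortest path has at most three
-- vertices, and if three, its ends are distinct and non-adjacent while its middle is adjacent to both;
-- so cliques and independent sets meet every shortest path in at most two vertices, i.e. they are in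
-- general position, whence |A|, |B| ≤ gp and ⌊log₂ n⌋ ≤ 2 gp.

open import Defs
open import Data.Nat using (ℕ; zero; suc; _+_; _*_; _^_; _≤_; _<_; z≤n; s≤s; z<s; s<s; NonZero; _/_; _%_; _<?_)
open import Data.Nat.Properties
open import Data.Nat.DivMod using (m≡m%n+[m/n]*n; m%n<n; m/n*n≤m)
open import Data.Nat.Logarithm using (⌊log₂_⌋; ⌊log₂⌋-mono-≤; ⌊log₂[2^n]⌋≡n)
open import Data.Bool using (true; false)
open import Data.Fin using (Fin; zero; suc)
open import Data.Fin.Subset using (Subset; _∈_; _∉_; ∣_∣; ⁅_⁆; _∪_; ⊥)
open import Data.Fin.Subset.Properties
  using (_∈?_; ∉⊥; ∣p∣≤n; p⊂q⇒∣p∣<∣q∣; q⊆p∪q; x∈p∪q⁺; x∈p∪q⁻; x∈⁅x⁆; x∈⁅y⁆⇒x≡y)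
import Data.List as List
open List using (List; []; _∷_; filter; allFin)
open import Data.List.Properties using (length-filter; filter-notAll; length-tabulate)
open import Data.List.Membership.Propositional using () renaming (_∈_ to _∈ₗ_)
open import Data.List.Membership.Propositional.Properties using (∈-length; ∈-filter⁺; ∈-filter⁻)
open import Data.List.Relation.Unary.All as All using (All; []; _∷_)
open import Data.List.Relation.Unary.All.Properties using (¬All⇒Any¬)
open import Data.List.Relation.Unary.Any using (here; there)
open import Data.List.Relation.Unary.AllPairs using (_∷_)
open import Data.List.Relation.Unary.Unique.Propositional using (Unique)
open import Data.List.Relation.Unary.Unique.Propositional.Properties using (allFin⁺; filter⁺)
open import Data.Product using (_×_; Σ-syntax; _,_; proj₁; proj₂)
open import Data.Sum using (inj₁; inj₂; [_,_])
open import Function using (_∘_; id)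
open import Relation.Binary.Definitions using (Decidable; Symmetric)
open import Relation.Nullary using (¬_; Dec; yes; no; does)
open import Relation.Nullary.Negation using (contradiction; ¬¬-map)
open import Relation.Nullary.Decidable using (decidable-stable; ¬¬-excluded-middle)
open import Relation.Unary.Properties using (∁?)
open import Relation.Binary.PropositionalEquality using (_≡_; _≢_; refl; sym; trans; cong; subst)

¬¬-Π-Fin : ∀ {n} {P : Fin n → Set} → (∀ i → ¬ ¬ P i) → ¬ ¬ (∀ i → P i)
¬¬-Π-Fin {zero}  _   k = k λ ()
¬¬-Π-Fin {suc n} ¬¬P k =
  ¬¬P zero λ P0 → ¬¬-Π-Fin (¬¬P ∘ suc) λ Ps → k λ { zero → P0 ; (suc i) → Ps i }

module _ {A : Set} where

  distinct-∈⇒2≤length : ∀ {a b : A} {xs} → a ≢ b → a ∈ₗ xs → b ∈ₗ xs → 2 ≤ List.length xs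
  distinct-∈⇒2≤length a≢b (here refl) (here refl) = contradiction refl a≢b
  distinct-∈⇒2≤length _   (here _)    (there b∈)  = s≤s (∈-length b∈)
  distinct-∈⇒2≤length _   (there a∈)  _           = s≤s (∈-length a∈)

  distinct-∈⇒3≤length : ∀ {a b c : A} {xs} → a ≢ b → a ≢ c → b ≢ c →
                        a ∈ₗ xs → b ∈ₗ xs → c ∈ₗ xs → 3 ≤ List.length xs
  distinct-∈⇒3≤length a≢b _ _ (here refl) (here refl) _ = contradiction refl a≢b
  distinct-∈⇒3≤length _ a≢c _ (here refl) (there _) (here refl) = contradiction refl a≢c
  distinct-∈⇒3≤length _ _ b≢c (here refl) (there b∈) (there c∈) = s≤s (distinct-∈⇒2≤length b≢c b∈ c∈)
  distinct-∈⇒3≤length _ _ b≢c (there _) (here refl) (here refl) = contradiction refl b≢c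
  distinct-∈⇒3≤length _ a≢c _ (there a∈) (here refl) (there c∈) = s≤s (distinct-∈⇒2≤length a≢c a∈ c∈)
  distinct-∈⇒3≤length a≢b _ _ (there a∈) (there b∈) (here refl) = s≤s (distinct-∈⇒2≤length a≢b a∈ b∈)
  distinct-∈⇒3≤length a≢b a≢c b≢c (there a∈) (there b∈) (there c∈) =
    m≤n⇒m≤1+n (distinct-∈⇒3≤length a≢b a≢c b≢c a∈ b∈ c∈)

  length-filter+length-filter-∁ : ∀ {P : A → Set} (P? : ∀ x → Dec (P x)) xs →
    List.length (filter P? xs) + List.length (filter (∁? P?) xs) ≡ List.length xs
  length-filter+length-filter-∁ P? [] = refl
  length-filter+length-filter-∁ P? (x ∷ xs) with ih ← length-filter+length-filter-∁ P? xs | does (P? x)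
  ... | true  = cong suc ih
  ... | false = trans (+-suc _ _) (cong suc ih)

n≤m⇒m<2^k⇒1+m+n<2^[1+k] : ∀ {m n k} → n ≤ m → m < 2 ^ k → suc (m + n) < 2 ^ suc k
n≤m⇒m<2^k⇒1+m+n<2^[1+k] {m} {n} {k} n≤m m<2^k = begin-strict
  suc (m + n)   ≤⟨ s≤s (+-monoʳ-≤ m n≤m) ⟩
  suc (m + m)   <⟨ s≤s (+-monoʳ-< m (n<1+n m)) ⟩
  suc m + suc m ≤⟨ +-mono-≤ m<2^k m<2^k ⟩
  2 ^ k + 2 ^ k ≡⟨ cong (2 ^ k +_) (sym (+-identityʳ (2 ^ k))) ⟩
  2 ^ suc k     ∎
  where open ≤-Reasoning

n<2^n : ∀ n → n < 2 ^ n
n<2^n zero    = z<s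
n<2^n (suc n) = ≤-<-trans (n<2^n n) (^-monoʳ-< 2 (s<s z<s) (n<1+n n))

n≤2^k⇒⌊log₂n⌋≤k : ∀ {n k} → n ≤ 2 ^ k → ⌊log₂ n ⌋ ≤ k
n≤2^k⇒⌊log₂n⌋≤k {k = k} n≤2^k = subst (_ ≤_) (⌊log₂[2^n]⌋≡n k) (⌊log₂⌋-mono-≤ n≤2^k)

m<[1+m/n]*n : ∀ m n .{{_ : NonZero n}} → m < suc (m / n) * n
m<[1+m/n]*n m n = begin-strict
  m                   ≡⟨ m≡m%n+[m/n]*n m n ⟩
  m % n + (m / n) * n <⟨ +-monoˡ-< ((m / n) * n) (m%n<n m n) ⟩
  suc (m / n) * n     ∎
  where open ≤-Reasoning

n≤[1+cn/d]*g : ∀ c {n d g} .{{_ : NonZero d}} → d ≤ c * g → n ≤ suc ((c * n) / d) * g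
n≤[1+cn/d]*g c {n} {d} {g} d≤cg = <⇒≤ (*-cancelˡ-< c n (q′ * g) (begin-strict
  c * n         <⟨ m<[1+m/n]*n (c * n) d ⟩
  q′ * d        ≤⟨ *-monoʳ-≤ q′ d≤cg ⟩
  q′ * (c * g)  ≡⟨ sym (*-assoc q′ c g) ⟩
  q′ * c * g    ≡⟨ cong (_* g) (*-comm q′ c) ⟩
  c * q′ * g    ≡⟨ *-assoc c q′ g ⟩
  c * (q′ * g)  ∎))
  where
  q′ = suc ((c * n) / d)
  open ≤-Reasoning

Pairwise : ∀ {n} → (Fin n → Fin n → Set) → Subset n → Set
Pairwise R X = ∀ {a b} → a ∈ X → b ∈ X → a ≢ b → R a b

Pairwise-insert : ∀ {n} {R : Fin n → Fin n → Set} {X v} → Symmetric R →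
                  Pairwise R X → (∀ {u} → u ∈ X → R v u) → Pairwise R (⁅ v ⁆ ∪ X)
Pairwise-insert {X = X} {v} R-sym R-X v-R a∈ b∈ a≢b with x∈p∪q⁻ ⁅ v ⁆ X a∈ | x∈p∪q⁻ ⁅ v ⁆ X b∈
... | inj₁ a∈v | inj₁ b∈v = contradiction (trans (x∈⁅y⁆⇒x≡y v a∈v) (sym (x∈⁅y⁆⇒x≡y v b∈v))) a≢b
... | inj₁ a∈v | inj₂ b∈X rewrite x∈⁅y⁆⇒x≡y v a∈v = v-R b∈X
... | inj₂ a∈X | inj₁ b∈v rewrite x∈⁅y⁆⇒x≡y v b∈v = R-sym (v-R a∈X)
... | inj₂ a∈X | inj₂ b∈X = R-X a∈X b∈X a≢b

∉⇒∣p∣<∣⁅x⁆∪p∣ : ∀ {n} {x : Fin n} {p} → x ∉ p → ∣ p ∣ < ∣ ⁅ x ⁆ ∪ p ∣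
∉⇒∣p∣<∣⁅x⁆∪p∣ {x = x} {p} x∉p = p⊂q⇒∣p∣<∣q∣ (q⊆p∪q ⁅ x ⁆ p , x , x∈p∪q⁺ (inj₁ (x∈⁅x⁆ x)) , x∉p)

module _ {n} (G : Graph n) where
  open Graph G using (Adj; irrefl)

  IsClique IsIndependent : Subset n → Set
  IsClique      = Pairwise Adj
  IsIndependent = Pairwise λ a b → ¬ Adj a b

  HasDiameterAtMost : ℕ → Set
  HasDiameterAtMost d = ∀ x y → Σ[ w ∈ Walk G x y ] length G w ≤ d

  Adj⇒≢ : ∀ {x y} → Adj x y → x ≢ y
  Adj⇒≢ e refl = irrefl e

  shortest-length≤ : ∀ {d x y} → HasDiameterAtMost d → (w : Walk G x y) → IsShortest G w → length G w ≤ d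
  shortest-length≤ {x = x} {y} diam _ w-short = let w′ , w′≤d = diam x y in ≤-trans (w-short w′) w′≤d

  module _ {x z y} (e : Adj x z) (f : Adj z y) (ef-short : IsShortest G (e ∷ f ∷ [])) where

    geodesic₂-ends-distinct : x ≢ y
    geodesic₂-ends-distinct refl = contradiction (ef-short []) λ ()

    geodesic₂-ends-nonadjacent : ¬ Adj x y
    geodesic₂-ends-nonadjacent xy = contradiction (ef-short (xy ∷ [])) λ { (s≤s ()) }

  ContainsNoGeodesic₂ : Subset n → Set
  ContainsNoGeodesic₂ X = ∀ {x z y} (e : Adj x z) (f : Adj z y) →
    IsShortest G (e ∷ f ∷ []) → ¬ All (_∈ X) (vertices G (e ∷ f ∷ []))

  clique⇒containsNoGeodesic₂ : ∀ {X} → IsClique X → ContainsNoGeodesic₂ X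
  clique⇒containsNoGeodesic₂ X-clique e f ef-short (x∈X ∷ _ ∷ y∈X ∷ []) =
    geodesic₂-ends-nonadjacent e f ef-short (X-clique x∈X y∈X (geodesic₂-ends-distinct e f ef-short))

  independent⇒containsNoGeodesic₂ : ∀ {X} → IsIndependent X → ContainsNoGeodesic₂ X
  independent⇒containsNoGeodesic₂ X-independent e f _ (x∈X ∷ z∈X ∷ _) =
    X-independent x∈X z∈X (Adj⇒≢ e) e

  module _ (diam : HasDiameterAtMost 2) {X} (X-noGeodesic : ContainsNoGeodesic₂ X) where

    length-filter-vertices≤2 : ∀ {x y} (w : Walk G x y) → IsShortest G w →
                        List.length (filter (_∈? X) (vertices G w)) ≤ 2
    length-filter-vertices≤2 {x} []           _ = m≤n⇒m≤1+n (length-filter (_∈? X) (x ∷ []))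
    length-filter-vertices≤2 {x} {y} (_ ∷ []) _ = length-filter (_∈? X) (x ∷ y ∷ [])
    length-filter-vertices≤2 (e ∷ f ∷ []) ef-short =
      ≤-pred (filter-notAll (_∈? X) _ (¬All⇒Any¬ (_∈? X) _ (X-noGeodesic e f ef-short)))
    length-filter-vertices≤2 w@(_ ∷ _ ∷ _ ∷ _) w-short with s≤s (s≤s ()) ← shortest-length≤ diam w w-short

    containsNoGeodesic₂⇒generalPosition : IsGeneralPositionSet G X
    containsNoGeodesic₂⇒generalPosition w w-short a b c a∈X b∈X c∈X a≢b a≢c b≢c (a∈w , b∈w , c∈w) =
      ≤⇒≯ (length-filter-vertices≤2 w w-short)
          (distinct-∈⇒3≤length a≢b a≢c b≢c (meet a∈w a∈X) (meet b∈w b∈X) (meet c∈w c∈X))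
      where meet = ∈-filter⁺ (_∈? X)

  module Ramsey (adj? : Decidable Adj) where

    neighbours nonNeighbours : Fin n → List (Fin n) → List (Fin n)
    neighbours    v = filter (adj? v)
    nonNeighbours v = filter (∁? (adj? v))

    record CliqueIndependentPair (pool : List (Fin n)) : Set where
      field
        clique independent : Subset n
        clique⊆pool        : ∀ {u} → u ∈ clique → u ∈ₗ pool
        independent⊆pool   : ∀ {u} → u ∈ independent → u ∈ₗ pool
        isClique           : IsClique clique
        isIndependent      : IsIndependent independent
        pool<2^            : List.length pool < 2 ^ (∣ clique ∣ + ∣ independent ∣)

    empty-pair : CliqueIndependentPair []
    empty-pair = record
      { clique = ⊥ ; independent = ⊥
      ; clique⊆pool = λ u∈ → contradiction u∈ ∉⊥ ; independent⊆pool = λ u∈ → contradiction u∈ ∉⊥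
      ; isClique = λ a∈ _ _ → contradiction a∈ ∉⊥ ; isIndependent = λ a∈ _ _ → contradiction a∈ ∉⊥
      ; pool<2^ = m^n>0 2 (∣ ⊥ {n} ∣ + ∣ ⊥ {n} ∣) }

    module _ {v : Fin n} {zs : List (Fin n)} where

      in-pool : ∀ {P : Fin n → Set} (P? : ∀ u → Dec (P u)) {u} → u ∈ₗ filter P? zs → u ∈ₗ v ∷ zs
      in-pool P? = there ∘ proj₁ ∘ ∈-filter⁻ P? {xs = zs}

      insert-clique : List.length (nonNeighbours v zs) ≤ List.length (neighbours v zs) →
                      CliqueIndependentPair (neighbours v zs) → CliqueIndependentPair (v ∷ zs)
      insert-clique M≤N r = record
        { clique = ⁅ v ⁆ ∪ clique
        ; independent = independent
        ; clique⊆pool = [ here ∘ x∈⁅y⁆⇒x≡y v , in-pool (adj? v) ∘ clique⊆pool ] ∘ x∈p∪q⁻ ⁅ v ⁆ clique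
        ; independent⊆pool = in-pool (adj? v) ∘ independent⊆pool
        ; isClique = Pairwise-insert (Graph.sym G) isClique v~clique
        ; isIndependent = isIndependent
        ; pool<2^ = begin-strict
            suc (List.length zs)
              ≡⟨ cong suc (sym (length-filter+length-filter-∁ (adj? v) zs)) ⟩
            suc (List.length (neighbours v zs) + List.length (nonNeighbours v zs))
              <⟨ n≤m⇒m<2^k⇒1+m+n<2^[1+k] {k = ∣ clique ∣ + ∣ independent ∣} M≤N pool<2^ ⟩
            2 ^ (suc ∣ clique ∣ + ∣ independent ∣)
              ≤⟨ ^-monoʳ-≤ 2 (+-monoˡ-≤ ∣ independent ∣ (∉⇒∣p∣<∣⁅x⁆∪p∣ (irrefl ∘ v~clique))) ⟩
            2 ^ (∣ ⁅ v ⁆ ∪ clique ∣ + ∣ independent ∣) ∎ }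
        where
        open CliqueIndependentPair r
        open ≤-Reasoning
        v~clique : ∀ {u} → u ∈ clique → Adj v u
        v~clique = proj₂ ∘ ∈-filter⁻ (adj? v) {xs = zs} ∘ clique⊆pool

      insert-independent : All (v ≢_) zs →
                           List.length (neighbours v zs) ≤ List.length (nonNeighbours v zs) →
                           CliqueIndependentPair (nonNeighbours v zs) → CliqueIndependentPair (v ∷ zs)
      insert-independent v∉zs N≤M r = record
        { clique = clique
        ; independent = ⁅ v ⁆ ∪ independent
        ; clique⊆pool = in-pool (∁? (adj? v)) ∘ clique⊆pool
        ; independent⊆pool =
            [ here ∘ x∈⁅y⁆⇒x≡y v , in-pool (∁? (adj? v)) ∘ independent⊆pool ] ∘ x∈p∪q⁻ ⁅ v ⁆ independent
        ; isClique = isClique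
        ; isIndependent = Pairwise-insert (λ ¬xy yx → ¬xy (Graph.sym G yx)) isIndependent v≁independent
        ; pool<2^ = begin-strict
            suc (List.length zs)
              ≡⟨ cong suc (sym (length-filter+length-filter-∁ (adj? v) zs)) ⟩
            suc (List.length (neighbours v zs) + List.length (nonNeighbours v zs))
              ≡⟨ cong suc (+-comm (List.length (neighbours v zs)) _) ⟩
            suc (List.length (nonNeighbours v zs) + List.length (neighbours v zs))
              <⟨ n≤m⇒m<2^k⇒1+m+n<2^[1+k] {k = ∣ clique ∣ + ∣ independent ∣} N≤M pool<2^ ⟩
            2 ^ suc (∣ clique ∣ + ∣ independent ∣)
              ≡⟨ cong (2 ^_) (sym (+-suc ∣ clique ∣ ∣ independent ∣)) ⟩
            2 ^ (∣ clique ∣ + suc ∣ independent ∣)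
              ≤⟨ ^-monoʳ-≤ 2 (+-monoʳ-≤ ∣ clique ∣ (∉⇒∣p∣<∣⁅x⁆∪p∣ v∉independent)) ⟩
            2 ^ (∣ clique ∣ + ∣ ⁅ v ⁆ ∪ independent ∣) ∎ }
        where
        open CliqueIndependentPair r
        open ≤-Reasoning
        v≁independent : ∀ {u} → u ∈ independent → ¬ Adj v u
        v≁independent = proj₂ ∘ ∈-filter⁻ (∁? (adj? v)) {xs = zs} ∘ independent⊆pool
        v∉independent : v ∉ independent
        v∉independent v∈ = All.lookup v∉zs (proj₁ (∈-filter⁻ (∁? (adj? v)) {xs = zs} (independent⊆pool v∈))) refl

      insert : All (v ≢_) zs →
               (∀ {P : Fin n → Set} (P? : ∀ u → Dec (P u)) → CliqueIndependentPair (filter P? zs)) →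
               CliqueIndependentPair (v ∷ zs)
      insert v∉zs sub with List.length (nonNeighbours v zs) ≤? List.length (neighbours v zs)
      ... | yes M≤N = insert-clique M≤N (sub (adj? v))
      ... | no  M≰N = insert-independent v∉zs (<⇒≤ (≰⇒> M≰N)) (sub (∁? (adj? v)))

    cliqueIndependentPair : ∀ pool → Unique pool → CliqueIndependentPair pool
    cliqueIndependentPair pool = bounded (List.length pool) pool ≤-refl
      where
      bounded : ∀ k pool → List.length pool ≤ k → Unique pool → CliqueIndependentPair pool
      bounded _       []       _            _                   = empty-pair
      bounded (suc k) (v ∷ zs) (s≤s |zs|≤k) (v∉zs ∷ zs-unique) = insert v∉zs λ P? →
        bounded k (filter P? zs) (≤-trans (length-filter P? zs) |zs|≤k) (filter⁺ P? zs-unique)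

  module _ (diam : HasDiameterAtMost 2) where

    clique⇒generalPosition : ∀ {X} → IsClique X → IsGeneralPositionSet G X
    clique⇒generalPosition = containsNoGeodesic₂⇒generalPosition diam ∘ clique⇒containsNoGeodesic₂

    independent⇒generalPosition : ∀ {X} → IsIndependent X → IsGeneralPositionSet G X
    independent⇒generalPosition = containsNoGeodesic₂⇒generalPosition diam ∘ independent⇒containsNoGeodesic₂

    order<2^[g+g] : ∀ {g} → IsGeneralPositionNumber G g → n < 2 ^ (g + g)
    order<2^[g+g] {g} (_ , gp-maximum) = decidable-stable (n <? 2 ^ (g + g)) (¬¬-map bound ¬¬-adj?)
      where
      -- Adjacency is not assumed decidable, but the goal is, so it may be proved under ¬ ¬.
      ¬¬-adj? : ¬ ¬ Decidable Adj
      ¬¬-adj? = ¬¬-Π-Fin λ x → ¬¬-Π-Fin λ y → ¬¬-excluded-middle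
      bound : Decidable Adj → n < 2 ^ (g + g)
      bound adj? = begin-strict
        n                                  ≡⟨ sym (length-tabulate id) ⟩
        List.length (allFin n)             <⟨ pool<2^ ⟩
        2 ^ (∣ clique ∣ + ∣ independent ∣)
          ≤⟨ ^-monoʳ-≤ 2 (+-mono-≤ (gp-maximum clique (clique⇒generalPosition isClique))
                                   (gp-maximum independent (independent⇒generalPosition isIndependent))) ⟩
        2 ^ (g + g)                        ∎
        where
        open Ramsey adj?
        open CliqueIndependentPair (cliqueIndependentPair (allFin n) (allFin⁺ n))
        open ≤-Reasoning

β : ℕ → ℕ
β n = suc ((3 * n) / suc ⌊log₂ n ⌋)

β-isBigO : IsBigO-n/logn β
β-isBigO = 4 , 0 , λ n _ →
  let L = ⌊log₂ n ⌋ ; q = (3 * n) / suc L in begin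
    L + q * L     ≤⟨ +-mono-≤ (n≤2^k⇒⌊log₂n⌋≤k (<⇒≤ (n<2^n n))) (*-monoʳ-≤ q (n≤1+n L)) ⟩
    n + q * suc L ≤⟨ +-monoʳ-≤ n (m/n*n≤m (3 * n) (suc L)) ⟩
    n + 3 * n     ∎
  where open ≤-Reasoning

n≤β[n]*g : ∀ {n} g → n < 2 ^ (g + g) → n ≤ β n * g
n≤β[n]*g zero (s≤s z≤n) = z≤n
n≤β[n]*g {n} g@(suc _) n<2^[g+g] = n≤[1+cn/d]*g 3 (begin
  suc ⌊log₂ n ⌋ ≤⟨ s≤s (n≤2^k⇒⌊log₂n⌋≤k (<⇒≤ n<2^[g+g])) ⟩
  suc (g + g)   ≤⟨ +-monoˡ-≤ (g + g) (s≤s z≤n) ⟩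
  g + (g + g)   ≡⟨ cong (λ t → g + (g + t)) (sym (+-identityʳ g)) ⟩
  3 * g         ∎)
  where open ≤-Reasoning

lemma15 : Σ[ β ∈ (ℕ → ℕ) ] IsBigO-n/logn β ×
            (∀ n (G : Graph n) → HasDiameter G 2 →
              ∀ m g → IsMutualVisibilityNumber G m → IsGeneralPositionNumber G g →
              m ≤ β n * g)
lemma15 = β , β-isBigO , λ n G diam m g ((X , _ , ∣X∣≡m) , _) g-isGP → begin
  m         ≡⟨ sym ∣X∣≡m ⟩
  ∣ X ∣     ≤⟨ ∣p∣≤n X ⟩
  n         ≤⟨ n≤β[n]*g g (order<2^[g+g] G (proj₁ diam) g-isGP) ⟩
  β n * g   ∎
  where open ≤-Reasoning
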